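{- Let $A$ be a setoid and $B$ a setoid family over $A$. The type family $\mathcal{W}_B:\mathrm{W}(A_0,B_0)\to\mathrm{W}(A_0,B_0)\to\mathsf{U}$ is a partial equivalence relation, i.e. the types \[\prod_{w,w'}\mathcal{W}_B\,w\,w'\to\mathcal{W}_B\,w'\,w \quad\text{and}\quad \prod_{w,w',w''}\mathcal{W}_B\,w\,w'\to\mathcal{W}_B\,w'\,w''\to\mathcal{W}_B\,w\,w''\] are inhabited.
   Context: Setting: intensional Martin-Löf type theory with $\Pi$-types and a universe $\mathsf{U}$ closed under $\Pi$ and containing intensional $\Sigma$-types, identity types, the unit type, W-types and dependent W-types (inductive families); logic is propositions-as-types. A setoid $X$ is a tuple $(X_0,\approx_X,r_X,s_X,t_X)$ with $X_0:\mathsf{U}$, $\approx_X:X_0\to X_0\to\mathsf{U}$ and terms witnessing reflexivity, symmetry, transitivity. An extensional function $f:X\Rightarrow Y$ is $f_0:X_0\to Y_0$ with a proof of $\prod_{x,x'}x\approx x'\to f_0x\approx f_0x'$. A setoid family $B$ over a setoid $A$ gives a setoid $B\,a$ (underlying type $B_0\,a$) for each $a:A_0$ and extensional transports $B_\alpha:B\,a\Rightarrow B\,a'$ for $\alpha:a\approx_A a'$, functorial up to $\approx$ and with $B_\alpha\approx B_{\alpha'}$ for all $\alpha,\alpha':a\approx_A a'$. Write $b\approx_\alpha b'$ for $B_\alpha\,b\approx_{B a'}b'$. $\mathrm{W}=\mathrm{W}(A_0,B_0)$ is the W-type with constructor $\mathsf{sup}\,a\,f$ ($a:A_0$, $f:B_0\,a\to\mathrm{W}$),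 and $\mathsf{n}:\mathrm{W}\to A_0$, $\mathsf{b}:\prod_w B_0(\mathsf{n}\,w)\to\mathrm{W}$ satisfy $\mathsf{n}(\mathsf{sup}\,a\,f)\equiv a$, $\mathsf{b}(\mathsf{sup}\,a\,f)\equiv f$. $\mathcal{W}_B:\mathrm{W}\to\mathrm{W}\to\mathsf{U}$ is the dependent W-type indexed by $\mathrm{W}\times\mathrm{W}$ with the single constructor: for $w,w':\mathrm{W}$, $\alpha:\mathsf{n}\,w\approx_A\mathsf{n}\,w'$ and $\phi:\prod_{z:\sum_{b:B_0(\mathsf{n}w)}\sum_{b':B_0(\mathsf{n}w')}b\approx_\alpha b'}\mathcal{W}_B\,(\mathsf{b}\,w\,(\mathrm{pr}_1z))\,(\mathsf{b}\,w'\,(\mathrm{pr}_2z))$, one has $\mathsf{dsup}\,(w,w')\,\alpha\,\phi:\mathcal{W}_B\,w\,w'$; it comes with the usual induction (elimination) principle. -}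

module Defs where

open import Data.Product using (Σ; _,_; proj₁; proj₂)

-- Setoids in the sense of the paper: a type with a proof-relevant
-- equivalence relation valued in the universe U (here: Set).
record Setoid : Set₁ where
  field
    Carrier : Set
    _≈_     : Carrier → Carrier → Set
    refl≈   : (x : Carrier) → x ≈ x
    sym≈    : {x y : Carrier} → x ≈ y → y ≈ x
    trans≈  : {x y z : Carrier} → x ≈ y → y ≈ z → x ≈ z
open Setoid public

record _⇒_ (X Y : Setoid) : Set where
  field
    fun : Carrier X → Carrier Y
    ext : (x x' : Carrier X) → _≈_ X x x' → _≈_ Y (fun x) (fun x')
open _⇒_ public

record SetoidFamily (A : Setoid) : Set₁ where
  field
    fam   : Carrier A → Setoid
    tr    : {a a' : Carrier A} → _≈_ A a a' → fam a ⇒ fam a'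
    tr-id : (a : Carrier A) (b : Carrier (fam a))
            → _≈_ (fam a) (fun (tr (refl≈ A a)) b) b
    tr-comp : {a a' a'' : Carrier A} (α : _≈_ A a a') (β : _≈_ A a' a'')
              (b : Carrier (fam a))
              → _≈_ (fam a'') (fun (tr β) (fun (tr α) b)) (fun (tr (trans≈ A α β)) b)
    tr-irr : {a a' : Carrier A} (α α' : _≈_ A a a') (b : Carrier (fam a))
             → _≈_ (fam a') (fun (tr α) b) (fun (tr α') b)
open SetoidFamily public

module _ (A : Setoid) (B : SetoidFamily A) where

  A₀ : Set
  A₀ = Carrier A

  B₀ : A₀ → Set
  B₀ a = Carrier (fam B a)

  _≈[_]_ : {a a' : A₀} → B₀ a → _≈_ A a a' → B₀ a' → Set
  _≈[_]_ {a' = a'} b α b' = _≈_ (fam B a') (fun (tr B α) b) b'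

  data W : Set where
    sup : (a : A₀) → (B₀ a → W) → W

  n : W → A₀
  n (sup a f) = a

  br : (w : W) → B₀ (n w) → W
  br (sup a f) = f

  data 𝒲 : W → W → Set where
    dsup : (w w' : W) (α : _≈_ A (n w) (n w'))
           → ((z : Σ (B₀ (n w)) λ b → Σ (B₀ (n w')) λ b' → b ≈[ α ] b')
              → 𝒲 (br w (proj₁ z)) (br w' (proj₁ (proj₂ z))))
           → 𝒲 w w'

-- A derivation of 𝒲_B w w' is a root witness α : n w ≈ n w' together with
-- derivations relating the branches along every pair b ≈[α] b'.  So the
-- induction steps only need the corresponding facts about the heterogeneous
-- relation b ≈[α] b' on fibres of a setoid family, which follow from the
-- functoriality laws (tr-id, tr-comp, tr-irr):
--   * transporting forth and back is the identity up to ≈;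
--   * b' ≈[α⁻¹] b implies b ≈[α] b'            (symmetry);
--   * b ≈[α∙β] b'' gives tr α b ≈[β] b''         (splitting).
-- Symmetry of 𝒲_B reverses the root witness and uses heterogeneous symmetry
-- to reorient the branch pairs; transitivity composes the root witnesses and
-- splits each pair b ≈[α∙β] b'' through the middle element tr α b.
module Submission where

open import Defs
open import Data.Product using (_×_; _,_)
import Relation.Binary.Bundles as Bundles
import Relation.Binary.Reasoning.Setoid as SetoidReasoning

toStdSetoid : Setoid → Bundles.Setoid _ _
toStdSetoid X = record
  { Carrier       = Carrier X
  ; _≈_           = _≈_ X
  ; isEquivalence = record
    { refl  = refl≈ X _
    ; sym   = sym≈ X
    ; trans = trans≈ X
    }
  }

module HeterogeneousEquality (A : Setoid) (B : SetoidFamily A) where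

  -- Transporting along any β : a' ≈ a and back along α : a ≈ a' is the
  -- identity up to ≈ (all witnesses of a' ≈ a' act like reflexivity).
  tr-roundtrip : {a a' : A₀ A B} (α : _≈_ A a a') (β : _≈_ A a' a)
                 (b' : B₀ A B a')
               → _≈_ (fam B a') (fun (tr B α) (fun (tr B β) b')) b'
  tr-roundtrip {a' = a'} α β b' = begin
    fun (tr B α) (fun (tr B β) b')  ≈⟨ tr-comp B β α b' ⟩
    fun (tr B (trans≈ A β α)) b'    ≈⟨ tr-irr B (trans≈ A β α) (refl≈ A a') b' ⟩
    fun (tr B (refl≈ A a')) b'      ≈⟨ tr-id B a' b' ⟩
    b'                              ∎
    where open SetoidReasoning (toStdSetoid (fam B a'))

  ≈[]-sym : {a a' : A₀ A B} (α : _≈_ A a a') {b : B₀ A B a} {b' : B₀ A B a'}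
          → _≈[_]_ A B b' (sym≈ A α) b → _≈[_]_ A B b α b'
  ≈[]-sym {a' = a'} α {b} {b'} p = begin
    fun (tr B α) b                               ≈⟨ ext (tr B α) _ _ p ⟨
    fun (tr B α) (fun (tr B (sym≈ A α)) b')      ≈⟨ tr-roundtrip α (sym≈ A α) b' ⟩
    b'                                           ∎
    where open SetoidReasoning (toStdSetoid (fam B a'))

  -- Together with b ≈[α] tr α b (reflexivity) this factors every pair related
  -- along a composite witness through the fibre over the middle point.
  ≈[]-split : {a a' a'' : A₀ A B} (α : _≈_ A a a') (β : _≈_ A a' a'')
              {b : B₀ A B a} {b'' : B₀ A B a''}
            → _≈[_]_ A B b (trans≈ A α β) b''
            → _≈[_]_ A B (fun (tr B α) b) β b''
  ≈[]-split {a'' = a''} α β {b} {b''} p = begin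
    fun (tr B β) (fun (tr B α) b)  ≈⟨ tr-comp B α β b ⟩
    fun (tr B (trans≈ A α β)) b    ≈⟨ p ⟩
    b''                            ∎
    where open SetoidReasoning (toStdSetoid (fam B a''))

module WRelation (A : Setoid) (B : SetoidFamily A) where
  open HeterogeneousEquality A B

  𝒲-sym : (w w' : W A B) → 𝒲 A B w w' → 𝒲 A B w' w
  𝒲-sym _ _ (dsup w w' α φ) =
    dsup w' w (sym≈ A α) λ { (b' , b , p) →
      𝒲-sym _ _ (φ (b , b' , ≈[]-sym α p)) }

  𝒲-trans : (w w' w'' : W A B) → 𝒲 A B w w' → 𝒲 A B w' w'' → 𝒲 A B w w''
  𝒲-trans _ _ _ (dsup w w' α φ) (dsup _ w'' β ψ) =
    dsup w w'' (trans≈ A α β) λ { (b , b'' , p) →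
      let b' = fun (tr B α) b
          b≈[α]b' = refl≈ (fam B (n A B w')) b'
      in 𝒲-trans _ _ _ (φ (b , b' , b≈[α]b')) (ψ (b' , b'' , ≈[]-split α β p)) }

proposition3p2 : (A : Setoid) (B : SetoidFamily A)
    → ((w w' : W A B) → 𝒲 A B w w' → 𝒲 A B w' w)
    × ((w w' w'' : W A B) → 𝒲 A B w w' → 𝒲 A B w' w'' → 𝒲 A B w w'')
proposition3p2 A B = 𝒲-sym , 𝒲-trans
  where open WRelation A B
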